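{- Let $n\ge2$, $1\le k\le n$ and $w\in S_n$. The K-Demazure crystal $\mathrm{SVT}^n_w(\Lambda_k)$ does not depend on the choice of reduced expression for $w$.
   Context: $\mathrm{SVT}^n(\Lambda_k)$ is the set of single-column semistandard set-valued tableaux of height $k$ with entries at most $n$: sequences of nonempty sets $A_1,\dots,A_k\subseteq\{1,\dots,n\}$ (top to bottom) with $\max A_r<\min A_{r+1}$. For $1\le i<n$ the crystal operators are: $f_iT=0$ unless $i\in T$ and $i+1\notin T$, in which case $f_iT$ replaces $i$ by $i+1$ in its box; $e_iT=0$ unless $i+1\in T$ and $i\notin T$, in which case $e_iT$ replaces $i+1$ by $i$. K-crystal operators: $f_i^KT=0$ if $i\notin T$ or $i+1\in T$; otherwise $f_i^KT$ adds $i+1$ to the box containing $i$. $e_i^KT=0$ if no box contains both $i$ and $i+1$; otherwise $e_i^KT$ deletes $i+1$ from that box. For $g\in\{e_i,e_i^K\}$, $g^{\max}T=g^rT$ with $r$ maximal such that $g^rT\ne0$. Let $u$ be the column with boxes $\{1\},\{2\},\dots,\{k\}$. For a reduced expression $w=s_{i_1}\cdots s_{i_\ell}$, $\mathrm{SVT}^n_w(\Lambda_k)=\{T\in\mathrm{SVT}^n(\Lambda_k) : (e^K_{i_\ell})^{\max}e_{i_\ell}^{\max}\cdots(e^K_{i_1})^{\max}e_{i_1}^{\max}T=u\}$ (rightmost operator applied first). -}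

module Defs where

open import Data.Nat using (ℕ; zero; suc; _≤_; _<_; _≡ᵇ_)
open import Data.Bool using (Bool; true; false; if_then_else_; _∧_; not; T)
open import Data.List using (List; []; _∷_; map; concat; length; upTo; filter; foldl)
open import Data.Bool.ListAction using (any)
open import Data.List.Relation.Unary.All using (All)
open import Data.List.Relation.Unary.Linked using (Linked)
open import Data.Maybe using (Maybe; just; nothing)
open import Data.Fin using (Fin; toℕ)
open import Data.Fin.Permutation using (Permutation′; _⟨$⟩ʳ_)
open import Data.Product using (_×_)
open import Relation.Binary.PropositionalEquality using (_≡_)
open import Relation.Nullary using (¬_)
open import Relation.Nullary.Decidable using (¬?)
open import Data.Nat using (_≟_)

-- Single-column set-valued tableaux.
-- A box is a finite set of positive integers, represented as a strictly
-- increasing list; a column is the list of its boxes from top to bottom.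

Box : Set
Box = List ℕ

Tab : Set
Tab = List Box

data NonEmpty {A : Set} : List A → Set where
  nonEmpty : ∀ x xs → NonEmpty (x ∷ xs)

-- T ∈ SVT^n(Λ_k): k nonempty boxes, entries in {1,…,n}, and the
-- concatenation of the boxes (top to bottom) strictly increasing
-- (this encodes both that boxes are sets, given as sorted lists, and
-- max A_r < min A_{r+1}).
SVT : ℕ → ℕ → Tab → Set
SVT n k t =
  length t ≡ k × All NonEmpty t × All (λ x → 1 ≤ x × x ≤ n) (concat t)
  × Linked _<_ (concat t)

_∈ᵇ_ : ℕ → Box → Bool
x ∈ᵇ b = any (λ y → x ≡ᵇ y) b

_∈ᵀ_ : ℕ → Tab → Bool
x ∈ᵀ t = any (λ b → x ∈ᵇ b) t

-- crystal raising operator e_i (nothing = 0)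
eOp : ℕ → Tab → Maybe Tab
eOp i t =
  if (suc i ∈ᵀ t) ∧ not (i ∈ᵀ t)
  then just (map (map (λ x → if x ≡ᵇ suc i then i else x)) t)
  else nothing

-- K-crystal raising operator e_i^K (nothing = 0)
eKOp : ℕ → Tab → Maybe Tab
eKOp i t =
  if any (λ b → (i ∈ᵇ b) ∧ (suc i ∈ᵇ b)) t
  then just (map (λ b → if (i ∈ᵇ b) ∧ (suc i ∈ᵇ b)
                        then filter (λ x → ¬? (x ≟ suc i)) b
                        else b) t)
  else nothing

iterMax : ℕ → (Tab → Maybe Tab) → Tab → Tab
iterMax zero g t = t
iterMax (suc m) g t with g t
... | nothing = t
... | just t′ = iterMax m g t′

-- On SVT^n(Λ_k) any e_i or e_i^K string has length ≤ 1 ≤ n, so fuel n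
-- computes exactly g^max.
gmax : ℕ → (Tab → Maybe Tab) → Tab → Tab
gmax n g t = iterMax n g t

-- (e^K_{iℓ})^max e_{iℓ}^max ⋯ (e^K_{i1})^max e_{i1}^max T
-- (rightmost first, so i1 is processed first)
lower : ℕ → List ℕ → Tab → Tab
lower n word t = foldl (λ s i → gmax n (eKOp i) (gmax n (eOp i) s)) t word

uCol : ℕ → Tab
uCol k = map (λ j → suc j ∷ []) (upTo k)

SVTw : ℕ → ℕ → List ℕ → Tab → Set
SVTw n k word t = SVT n k t × lower n word t ≡ uCol k

ValidWord : ℕ → List ℕ → Set
ValidWord n word = All (λ i → 1 ≤ i × i < n) word

sAct : ℕ → ℕ → ℕ
sAct i x = if x ≡ᵇ i then suc i else (if x ≡ᵇ suc i then i else x)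

wordAct : List ℕ → ℕ → ℕ
wordAct [] x = x
wordAct (i ∷ is) x = sAct i (wordAct is x)

-- the word represents the permutation w (w acts on Fin n ≅ {1,…,n})
Represents : (n : ℕ) → Permutation′ n → List ℕ → Set
Represents n w word = ∀ (x : Fin n) → wordAct word (suc (toℕ x)) ≡ suc (toℕ (w ⟨$⟩ʳ x))

IsReducedExpr : (n : ℕ) → Permutation′ n → List ℕ → Set
IsReducedExpr n w word =
  ValidWord n word × Represents n w word
  × (∀ word′ → ValidWord n word′ → Represents n w word′ → length word ≤ length word′)

module Submission where

-- Idea: we characterise membership in SVT^n_w(Λ_k) by a condition that
-- visibly depends on w only.  For a column t write  boxes m t  for the
-- number of boxes of t all of whose entries are ≤ m, and for a word r
-- write  img r k  (img (wordAct r) k in the code) for the set w({1,…,k})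
-- of the permutation w it represents.
-- For a REDUCED word a and a column t of height k we show
--
--     lower a t ≡ u   ⇔   ∀ m,  #(img a k ∩ [1,m]) ≤ boxes m t.     (★)
--
-- The proof of (★) is by induction on a = i ∷ r.  One step of the
-- lowering, (e_i^K)^max ∘ e_i^max, only changes  boxes i t , while passing
-- from img r k to img (i ∷ r) k = s_i(img r k) only changes the count at
-- m = i; reducedness of i ∷ r (via the exchange lemma) excludes the single
-- configuration i+1 ∈ img r k, i ∉ img r k, in which the two inequalities
-- at m = i would disagree.  The base case a = [] says that the only
-- column with  boxes m t ≥ min(m,k)  for all m is u itself.

open import Defs
open import Data.Bool using (Bool; true; false; if_then_else_; _∧_; _∨_; not; T)
open import Data.Bool.Properties using (∨-conicalˡ; ∨-conicalʳ; ∨-zeroʳ; ∧-zeroʳ)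
open import Data.Bool.ListAction using (any)
open import Data.Empty using (⊥; ⊥-elim)
open import Data.Fin using (toℕ; fromℕ<)
open import Data.Fin.Properties using (toℕ-fromℕ<)
open import Data.Fin.Permutation using (Permutation′)
open import Data.List using (List; []; _∷_; map; concat; length; filter; _++_; applyUpTo)
open import Data.List.Properties using (concat-map; length-map)
open import Data.List.Relation.Unary.All as All using (All; []; _∷_)
import Data.List.Relation.Unary.All.Properties as All
open import Data.List.Relation.Unary.AllPairs as AllPairs using (AllPairs; []; _∷_)
import Data.List.Relation.Unary.AllPairs.Properties as AllPairs
open import Data.List.Relation.Unary.Linked.Properties using (Linked⇒AllPairs)
open import Data.Maybe using (Maybe; just; nothing)
open import Data.Nat using (ℕ; zero; suc; _+_; _∸_; _⊓_; _≤_; _<_; _≡ᵇ_; _≤ᵇ_; z≤n; s≤s; _≟_; _≤?_; _<?_)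
open import Data.Nat.Properties
open import Algebra.Properties.CommutativeSemigroup +-commutativeSemigroup using (x∙yz≈y∙xz)
open import Data.Product using (_×_; _,_; proj₁; proj₂; Σ)
open import Data.Sum using (_⊎_; inj₁; inj₂)
open import Data.Unit using (⊤; tt)
open import Function.Base using (id)
open import Function.Bundles using (_⇔_; mk⇔; Equivalence)
open import Function.Construct.Composition using (_⇔-∘_)
open import Relation.Binary.PropositionalEquality
open import Relation.Nullary using (¬_; yes; no)
open import Relation.Nullary.Decidable using (¬?)

≡ᵇ-refl : ∀ x → (x ≡ᵇ x) ≡ true
≡ᵇ-refl zero = refl
≡ᵇ-refl (suc x) = ≡ᵇ-refl x

≡ᵇ-sound : ∀ {x y} → (x ≡ᵇ y) ≡ true → x ≡ y
≡ᵇ-sound {x} {y} e = ≡ᵇ⇒≡ x y (subst T (sym e) tt)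

≢⇒≡ᵇ-false : ∀ {x y} → x ≢ y → (x ≡ᵇ y) ≡ false
≢⇒≡ᵇ-false {x} {y} x≢y with x ≡ᵇ y in e
... | true = ⊥-elim (x≢y (≡ᵇ-sound e))
... | false = refl

≡ᵇ-false⇒≢ : ∀ {x y} → (x ≡ᵇ y) ≡ false → x ≢ y
≡ᵇ-false⇒≢ {x} e refl with () ← trans (sym (≡ᵇ-refl x)) e

≤⇒≤ᵇ-true : ∀ {x m} → x ≤ m → (x ≤ᵇ m) ≡ true
≤⇒≤ᵇ-true {x} {m} x≤m with x ≤ᵇ m | ≤⇒≤ᵇ x≤m
... | true | _ = refl

>⇒≤ᵇ-false : ∀ {x m} → m < x → (x ≤ᵇ m) ≡ false
>⇒≤ᵇ-false {x} {m} m<x with x ≤ᵇ m in e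
... | false = refl
... | true = ⊥-elim (<⇒≱ m<x (≤ᵇ⇒≤ x m (subst T (sym e) tt)))

≤ᵇ-sound : ∀ {x m} → (x ≤ᵇ m) ≡ true → x ≤ m
≤ᵇ-sound {x} {m} e = ≤ᵇ⇒≤ x m (subst T (sym e) tt)

≤ᵇ-suc : ∀ {x m} → x ≢ suc m → (x ≤ᵇ suc m) ≡ (x ≤ᵇ m)
≤ᵇ-suc {x} {m} x≢1+m with x ≤? m
... | yes x≤m = trans (≤⇒≤ᵇ-true (m≤n⇒m≤1+n x≤m)) (sym (≤⇒≤ᵇ-true x≤m))
... | no x≰m = trans (>⇒≤ᵇ-false (≤∧≢⇒< (≰⇒> x≰m) (≢-sym x≢1+m))) (sym (>⇒≤ᵇ-false (≰⇒> x≰m)))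

≤ᵇ-shift : ∀ i m → m ≢ i → (i ≤ᵇ m) ≡ (suc i ≤ᵇ m)
≤ᵇ-shift i m m≢i with suc i ≤? m
... | yes i<m = trans (≤⇒≤ᵇ-true (<⇒≤ i<m)) (sym (≤⇒≤ᵇ-true i<m))
... | no i≮m = trans (>⇒≤ᵇ-false (≤∧≢⇒< (≤-pred (≰⇒> i≮m)) m≢i)) (sym (>⇒≤ᵇ-false (≰⇒> i≮m)))

∨-trueˡ : ∀ {a b} → a ≡ true → a ∨ b ≡ true
∨-trueˡ refl = refl

∨-trueʳ : ∀ {a b} → b ≡ true → a ∨ b ≡ true
∨-trueʳ {a} refl = ∨-zeroʳ a

∨-true : ∀ {a b} → a ∨ b ≡ true → a ≡ true ⊎ b ≡ true
∨-true {true} _ = inj₁ refl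
∨-true {false} e = inj₂ e

∨-false : ∀ {a b} → a ∨ b ≡ false → a ≡ false × b ≡ false
∨-false {a} {b} e = ∨-conicalˡ a b e , ∨-conicalʳ a b e

∧-true : ∀ {a b} → a ∧ b ≡ true → a ≡ true × b ≡ true
∧-true {true} {true} _ = refl , refl

true≢false : true ≢ false
true≢false ()

sAct-i : ∀ i → sAct i i ≡ suc i
sAct-i i rewrite ≡ᵇ-refl i = refl

sAct-1+i : ∀ i → sAct i (suc i) ≡ i
sAct-1+i i rewrite ≢⇒≡ᵇ-false (1+n≢n {i}) | ≡ᵇ-refl i = refl

sAct-fix : ∀ {i x} → x ≢ i → x ≢ suc i → sAct i x ≡ x
sAct-fix x≢i x≢1+i rewrite ≢⇒≡ᵇ-false x≢i | ≢⇒≡ᵇ-false x≢1+i = refl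

data SCase (i x : ℕ) : Set where
  at-i   : x ≡ i → SCase i x
  at-1+i : x ≡ suc i → SCase i x
  away   : x ≢ i → x ≢ suc i → SCase i x

sCase : ∀ i x → SCase i x
sCase i x with x ≟ i | x ≟ suc i
... | yes x≡i | _ = at-i x≡i
... | no _ | yes x≡1+i = at-1+i x≡1+i
... | no x≢i | no x≢1+i = away x≢i x≢1+i

sAct-involutive : ∀ i x → sAct i (sAct i x) ≡ x
sAct-involutive i x with sCase i x
... | at-i refl rewrite sAct-i i = sAct-1+i i
... | at-1+i refl rewrite sAct-1+i i = sAct-i i
... | away x≢i x≢1+i rewrite sAct-fix x≢i x≢1+i = sAct-fix x≢i x≢1+i

sAct-injective : ∀ i {x y} → sAct i x ≡ sAct i y → x ≡ y
sAct-injective i {x} {y} e =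
  trans (sym (sAct-involutive i x)) (trans (cong (sAct i) e) (sAct-involutive i y))

sAct-inversion : ∀ j x y → x ≤ y → sAct j y < sAct j x → x ≡ j × y ≡ suc j
sAct-inversion j x y x≤y lt with sCase j x | sCase j y
... | at-i refl | at-i refl = ⊥-elim (<-irrefl refl lt)
... | at-i refl | at-1+i refl = refl , refl
... | at-i refl | away y≢j y≢1+j rewrite sAct-i x | sAct-fix y≢j y≢1+j =
  ⊥-elim (y≢j (≤-antisym (≤-pred lt) x≤y))
... | at-1+i refl | at-i refl = ⊥-elim (1+n≰n x≤y)
... | at-1+i refl | at-1+i refl = ⊥-elim (<-irrefl refl lt)
... | at-1+i refl | away y≢j y≢1+j rewrite sAct-1+i j | sAct-fix y≢j y≢1+j =
  ⊥-elim (1+n≰n (≤-trans x≤y (≤-trans (n≤1+n y) lt)))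
... | away x≢j x≢1+j | at-i refl rewrite sAct-fix x≢j x≢1+j | sAct-i y =
  ⊥-elim (1+n≰n (≤-trans (≤-trans (n≤1+n _) lt) x≤y))
... | away x≢j x≢1+j | at-1+i refl rewrite sAct-fix x≢j x≢1+j | sAct-1+i j =
  ⊥-elim (x≢1+j (≤-antisym x≤y lt))
... | away x≢j x≢1+j | away y≢j y≢1+j rewrite sAct-fix x≢j x≢1+j | sAct-fix y≢j y≢1+j =
  ⊥-elim (<-irrefl refl (<-≤-trans lt x≤y))

transp : ℕ → ℕ → ℕ → ℕ
transp p q v = if v ≡ᵇ p then q else (if v ≡ᵇ q then p else v)

transp-p : ∀ p q → transp p q p ≡ q
transp-p p q rewrite ≡ᵇ-refl p = refl

transp-q : ∀ p q → transp p q q ≡ p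
transp-q p q with q ≟ p
... | yes refl rewrite ≡ᵇ-refl q = refl
... | no q≢p rewrite ≢⇒≡ᵇ-false q≢p | ≡ᵇ-refl q = refl

transp-fix : ∀ {p q v} → v ≢ p → v ≢ q → transp p q v ≡ v
transp-fix v≢p v≢q rewrite ≢⇒≡ᵇ-false v≢p | ≢⇒≡ᵇ-false v≢q = refl

transp-conj : ∀ j p q v → sAct j (transp p q v) ≡ transp (sAct j p) (sAct j q) (sAct j v)
transp-conj j p q v with v ≟ p | v ≟ q
... | yes refl | _ rewrite transp-p v q | transp-p (sAct j v) (sAct j q) = refl
... | no _ | yes refl rewrite transp-q p v | transp-q (sAct j p) (sAct j v) = refl
... | no v≢p | no v≢q rewrite transp-fix v≢p v≢q =
  sym (transp-fix (λ e → v≢p (sAct-injective j e)) (λ e → v≢q (sAct-injective j e)))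

transp-sAct : ∀ j v → transp (suc j) j v ≡ sAct j v
transp-sAct j v with sCase j v
... | at-i refl rewrite transp-q (suc v) v | sAct-i v = refl
... | at-1+i refl rewrite transp-p (suc j) j | sAct-1+i j = refl
... | away v≢j v≢1+j rewrite transp-fix v≢1+j v≢j | sAct-fix v≢j v≢1+j = refl

exchange : ∀ {P : ℕ → Set} r y z → y < z → wordAct r z < wordAct r y → All P r →
  Σ (List ℕ) λ r′ → length r′ < length r × All P r′ ×
    (∀ x → wordAct r′ x ≡ transp (wordAct r y) (wordAct r z) (wordAct r x))
exchange [] y z y<z lt _ = ⊥-elim (<-asym y<z lt)
exchange (j ∷ r) y z y<z lt (pj ∷ pr) with wordAct r y ≤? wordAct r z
... | yes ry≤rz = r , ≤-refl , pr , λ x → sym (deleteHead x)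
  where
  open ≡-Reasoning
  ends : wordAct r y ≡ j × wordAct r z ≡ suc j
  ends = sAct-inversion j (wordAct r y) (wordAct r z) ry≤rz lt
  deleteHead : ∀ x → transp (sAct j (wordAct r y)) (sAct j (wordAct r z)) (sAct j (wordAct r x))
                       ≡ wordAct r x
  deleteHead x = begin
    transp (sAct j (wordAct r y)) (sAct j (wordAct r z)) (sAct j (wordAct r x))
      ≡⟨ cong₂ (λ p q → transp p q (sAct j (wordAct r x)))
               (trans (cong (sAct j) (proj₁ ends)) (sAct-i j))
               (trans (cong (sAct j) (proj₂ ends)) (sAct-1+i j)) ⟩
    transp (suc j) j (sAct j (wordAct r x))
      ≡⟨ transp-sAct j (sAct j (wordAct r x)) ⟩
    sAct j (sAct j (wordAct r x))
      ≡⟨ sAct-involutive j (wordAct r x) ⟩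
    wordAct r x ∎
... | no ry≰rz with exchange r y z y<z (≰⇒> ry≰rz) pr
...   | r′ , shorter , pr′ , eq = j ∷ r′ , s≤s shorter , pj ∷ pr′ , λ x →
  trans (cong (sAct j) (eq x)) (transp-conj j (wordAct r y) (wordAct r z) (wordAct r x))

invAct : List ℕ → ℕ → ℕ
invAct [] x = x
invAct (j ∷ r) x = invAct r (sAct j x)

wordAct-invAct : ∀ r x → wordAct r (invAct r x) ≡ x
wordAct-invAct [] x = refl
wordAct-invAct (j ∷ r) x = trans (cong (sAct j) (wordAct-invAct r (sAct j x))) (sAct-involutive j x)

wordAct-zero : ∀ {n} r → ValidWord n r → wordAct r 0 ≡ 0
wordAct-zero [] _ = refl
wordAct-zero (j ∷ r) ((1≤j , _) ∷ valid) rewrite wordAct-zero r valid =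
  sAct-fix (λ e → <-irrefl e 1≤j) (λ ())

Reduced : ℕ → List ℕ → Set
Reduced n a = ∀ a′ → ValidWord n a′ → (∀ x → wordAct a′ x ≡ wordAct a x) → length a ≤ length a′

reduced-tail : ∀ {n i r} → 1 ≤ i × i < n → Reduced n (i ∷ r) → Reduced n r
reduced-tail vi red a′ valid eq = ≤-pred (red (_ ∷ a′) (vi ∷ valid) (λ x → cong (sAct _) (eq x)))

reduced-of-expr : ∀ n w a → IsReducedExpr n w a → Reduced n a
reduced-of-expr n w a (_ , rep , minimal) a′ valid eq =
  minimal a′ valid (λ x → trans (eq (suc (toℕ x))) (rep x))

anyUpTo : ℕ → (ℕ → Bool) → Bool
anyUpTo zero p = false
anyUpTo (suc k) p = p (suc k) ∨ anyUpTo k p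

anyUpTo-true : ∀ k p → anyUpTo k p ≡ true → Σ ℕ λ y → 1 ≤ y × y ≤ k × p y ≡ true
anyUpTo-true zero p ()
anyUpTo-true (suc k) p e with p (suc k) in pk
... | true = suc k , s≤s z≤n , ≤-refl , pk
... | false with anyUpTo-true k p e
...   | y , 1≤y , y≤k , py = y , 1≤y , m≤n⇒m≤1+n y≤k , py

anyUpTo-false : ∀ k p → anyUpTo k p ≡ false → ∀ y → 1 ≤ y → y ≤ k → p y ≡ false
anyUpTo-false zero p e y 1≤y y≤k = ⊥-elim (<-irrefl refl (≤-trans 1≤y y≤k))
anyUpTo-false (suc k) p e y 1≤y y≤k with y ≟ suc k
... | yes refl = proj₁ (∨-false e)
... | no y≢1+k = anyUpTo-false k p (proj₂ (∨-false e)) y 1≤y (≤-pred (≤∧≢⇒< y≤k y≢1+k))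

anyUpTo-cong : ∀ k p q → (∀ y → 1 ≤ y → y ≤ k → p y ≡ q y) → anyUpTo k p ≡ anyUpTo k q
anyUpTo-cong zero p q h = refl
anyUpTo-cong (suc k) p q h =
  cong₂ _∨_ (h (suc k) (s≤s z≤n) ≤-refl) (anyUpTo-cong k p q (λ y a b → h y a (m≤n⇒m≤1+n b)))

img : (ℕ → ℕ) → ℕ → ℕ → Bool
img g k v = anyUpTo k (λ y → g y ≡ᵇ v)

-- Key consequence of reducedness: if i ∷ r is reduced, r({1,…,k}) cannot
-- contain i+1 while missing i; otherwise the pair (y, r⁻¹(i)) is inverted
-- by r and exchanging it would shorten i ∷ r.
reduced-no-ascent : ∀ {n k i r} → ValidWord n (i ∷ r) → Reduced n (i ∷ r) →
  img (wordAct r) k (suc i) ≡ true → img (wordAct r) k i ≡ false → ⊥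
reduced-no-ascent {n} {k} {i} {r} valid@((1≤i , _) ∷ validr) red hasSuc missesI
  with anyUpTo-true k (λ y → wordAct r y ≡ᵇ suc i) hasSuc
... | y , _ , y≤k , ry = 1+n≰n (≤-trans (red r′ validr′ sameAct) (≤-trans (n≤1+n _) shorter))
  where
  z = invAct r i
  rz : wordAct r z ≡ i
  rz = wordAct-invAct r i
  ry≡ : wordAct r y ≡ suc i
  ry≡ = ≡ᵇ-sound ry
  z≢0 : z ≢ 0
  z≢0 z≡0 = <-irrefl (trans (sym (wordAct-zero r validr)) (trans (cong (wordAct r) (sym z≡0)) rz)) 1≤i
  k<z : k < z
  k<z with k <? z
  ... | yes k<z = k<z
  ... | no k≮z with () ← trans (sym (anyUpTo-false k _ missesI z (n≢0⇒n>0 z≢0) (≮⇒≥ k≮z)))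
                               (trans (cong (_≡ᵇ i) rz) (≡ᵇ-refl i))
  inverted : wordAct r z < wordAct r y
  inverted rewrite rz | ry≡ = n<1+n i
  ex = exchange r y z (≤-<-trans y≤k k<z) inverted validr
  r′ = proj₁ ex
  shorter : length r′ < length r
  shorter = proj₁ (proj₂ ex)
  validr′ : ValidWord n r′
  validr′ = proj₁ (proj₂ (proj₂ ex))
  sameAct : ∀ x → wordAct r′ x ≡ wordAct (i ∷ r) x
  sameAct x rewrite proj₂ (proj₂ (proj₂ ex)) x | rz | ry≡ = transp-sAct i (wordAct r x)

img-reducedExpr : ∀ n k w a b → k ≤ n → IsReducedExpr n w a → IsReducedExpr n w b →
  ∀ v → img (wordAct a) k v ≡ img (wordAct b) k v
img-reducedExpr n k w a b k≤n (_ , repa , _) (_ , repb , _) v = anyUpTo-cong k _ _ sameValue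
  where
  agree : ∀ y → suc y ≤ n → wordAct a (suc y) ≡ wordAct b (suc y)
  agree y y<n = subst (λ u → wordAct a (suc u) ≡ wordAct b (suc u)) (toℕ-fromℕ< y<n)
    (trans (repa (fromℕ< y<n)) (sym (repb (fromℕ< y<n))))
  sameValue : ∀ y → 1 ≤ y → y ≤ k → (wordAct a y ≡ᵇ v) ≡ (wordAct b y ≡ᵇ v)
  sameValue (suc y) _ y<k = cong (_≡ᵇ v) (agree y (≤-trans y<k k≤n))

ind : Bool → ℕ
ind true = 1
ind false = 0

ind-mono : ∀ {a b} → (a ≡ true → b ≡ true) → ind a ≤ ind b
ind-mono {false} _ = z≤n
ind-mono {true} h rewrite h refl = ≤-refl

ind≤1 : ∀ b → ind b ≤ 1
ind≤1 true = ≤-refl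
ind≤1 false = z≤n

count : (ℕ → Bool) → ℕ → ℕ
count P zero = 0
count P (suc m) = ind (P (suc m)) + count P m

count-cong : ∀ P Q m → (∀ v → 1 ≤ v → v ≤ m → P v ≡ Q v) → count P m ≡ count Q m
count-cong P Q zero h = refl
count-cong P Q (suc m) h = cong₂ _+_ (cong ind (h (suc m) (s≤s z≤n) ≤-refl))
  (count-cong P Q m (λ v a b → h v a (m≤n⇒m≤1+n b)))

img-sAct : ∀ i g k v → img (λ y → sAct i (g y)) k v ≡ img g k (sAct i v)
img-sAct i g k v = anyUpTo-cong k _ _ λ y _ _ → begin
  (sAct i (g y) ≡ᵇ v)                      ≡⟨ cong (sAct i (g y) ≡ᵇ_) (sym (sAct-involutive i v)) ⟩
  (sAct i (g y) ≡ᵇ sAct i (sAct i v))      ≡⟨ injective-≡ᵇ (g y) (sAct i v) ⟩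
  (g y ≡ᵇ sAct i v)                        ∎
  where
  open ≡-Reasoning
  injective-≡ᵇ : ∀ x z → (sAct i x ≡ᵇ sAct i z) ≡ (x ≡ᵇ z)
  injective-≡ᵇ x z with x ≟ z
  ... | yes refl rewrite ≡ᵇ-refl (sAct i x) | ≡ᵇ-refl x = refl
  ... | no x≢z rewrite ≢⇒≡ᵇ-false x≢z | ≢⇒≡ᵇ-false (λ e → x≢z (sAct-injective i e)) = refl

-- Relabelling by s_i (i = j+1) changes the counts only at m = i: below i
-- nothing moves, and from i+1 on both i and i+1 are counted.
module CountSwap (P : ℕ → Bool) (j : ℕ) where
  Ps : ℕ → Bool
  Ps v = P (sAct (suc j) v)

  count-below : ∀ m → m ≤ j → count Ps m ≡ count P m
  count-below zero _ = refl
  count-below (suc m) m<j = cong₂ _+_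
    (cong (λ u → ind (P u)) (sAct-fix (<⇒≢ (s≤s m<j)) (<⇒≢ (s≤s (m≤n⇒m≤1+n m<j)))))
    (count-below m (≤-trans (n≤1+n m) m<j))

  count-at : count Ps (suc j) ≡ ind (P (suc (suc j))) + count P j
  count-at = cong₂ _+_ (cong (λ u → ind (P u)) (sAct-i (suc j))) (count-below j ≤-refl)

  count-above : ∀ d → count Ps (d + suc (suc j)) ≡ count P (d + suc (suc j))
  count-above zero = begin
    ind (P (sAct (suc j) (suc (suc j)))) + (ind (P (sAct (suc j) (suc j))) + count Ps j)
      ≡⟨ cong₂ (λ a b → ind (P a) + (ind (P b) + count Ps j)) (sAct-1+i (suc j)) (sAct-i (suc j)) ⟩
    ind (P (suc j)) + (ind (P (suc (suc j))) + count Ps j)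
      ≡⟨ cong (λ u → ind (P (suc j)) + (ind (P (suc (suc j))) + u)) (count-below j ≤-refl) ⟩
    ind (P (suc j)) + (ind (P (suc (suc j))) + count P j)
      ≡⟨ x∙yz≈y∙xz (ind (P (suc j))) (ind (P (suc (suc j)))) (count P j) ⟩
    ind (P (suc (suc j))) + (ind (P (suc j)) + count P j) ∎
    where open ≡-Reasoning
  count-above (suc d) = cong₂ _+_
    (cong (λ u → ind (P u)) (sAct-fix (>⇒≢ (<-trans (n<1+n _) beyond)) (>⇒≢ beyond)))
    (count-above d)
    where
    beyond : suc (suc j) < suc (d + suc (suc j))
    beyond = s≤s (m≤n+m _ d)

  count-swap : ∀ m → m ≢ suc j → count Ps m ≡ count P m
  count-swap m m≢i with m ≤? j
  ... | yes m≤j = count-below m m≤j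
  ... | no m≰j = subst (λ u → count Ps u ≡ count P u) (m∸n+n≡m i<m) (count-above (m ∸ suc (suc j)))
    where
    i<m : suc (suc j) ≤ m
    i<m = ≤∧≢⇒< (≰⇒> m≰j) (≢-sym m≢i)

∈ᵇ-++ : ∀ x xs ys → x ∈ᵇ (xs ++ ys) ≡ (x ∈ᵇ xs ∨ x ∈ᵇ ys)
∈ᵇ-++ x [] ys = refl
∈ᵇ-++ x (y ∷ xs) ys rewrite ∈ᵇ-++ x xs ys with x ≡ᵇ y
... | true = refl
... | false = refl

∈ᵀ-concat : ∀ x t → x ∈ᵀ t ≡ x ∈ᵇ concat t
∈ᵀ-concat x [] = refl
∈ᵀ-concat x (b ∷ t) rewrite ∈ᵇ-++ x b (concat t) | ∈ᵀ-concat x t = refl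

All-∈ᵇ : ∀ {P : ℕ → Set} {x} xs → All P xs → x ∈ᵇ xs ≡ true → P x
All-∈ᵇ {P} {x} (y ∷ xs) (py ∷ pxs) e with x ≡ᵇ y in x≡y
... | true = subst P (sym (≡ᵇ-sound x≡y)) py
... | false = All-∈ᵇ xs pxs e

All>⇒∉ᵇ : ∀ {v} ys → All (v <_) ys → v ∈ᵇ ys ≡ false
All>⇒∉ᵇ [] [] = refl
All>⇒∉ᵇ {v} (y ∷ ys) (v<y ∷ ps) rewrite ≢⇒≡ᵇ-false (<⇒≢ v<y) = All>⇒∉ᵇ ys ps

∉ᵇ⇒All≢ : ∀ v xs → v ∈ᵇ xs ≡ false → All (_≢ v) xs
∉ᵇ⇒All≢ v [] e = []
∉ᵇ⇒All≢ v (x ∷ xs) e with v ≡ᵇ x in v≟x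
... | false = (λ x≡v → ≡ᵇ-false⇒≢ v≟x (sym x≡v)) ∷ ∉ᵇ⇒All≢ v xs e

∉ᵀ⇒All∉ᵇ : ∀ x t → x ∈ᵀ t ≡ false → All (λ b → x ∈ᵇ b ≡ false) t
∉ᵀ⇒All∉ᵇ x [] e = []
∉ᵀ⇒All∉ᵇ x (b ∷ t) e = proj₁ (∨-false e) ∷ ∉ᵀ⇒All∉ᵇ x t (proj₂ (∨-false e))

∈ᵇ-map : ∀ (f : ℕ → ℕ) x xs → x ∈ᵇ xs ≡ true → f x ∈ᵇ map f xs ≡ true
∈ᵇ-map f x (y ∷ xs) e with x ≡ᵇ y in x≡y
... | true = ∨-trueˡ (trans (cong (λ u → f u ≡ᵇ f y) (≡ᵇ-sound x≡y)) (≡ᵇ-refl (f y)))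
... | false = ∨-trueʳ (∈ᵇ-map f x xs e)

∈ᵀ-map : ∀ (f : ℕ → ℕ) x t → x ∈ᵀ t ≡ true → f x ∈ᵀ map (map f) t ≡ true
∈ᵀ-map f x (b ∷ t) e with ∨-true {x ∈ᵇ b} e
... | inj₁ inB = ∨-trueˡ (∈ᵇ-map f x b inB)
... | inj₂ inT = ∨-trueʳ (∈ᵀ-map f x t inT)

∉ᵇ-map : ∀ (f : ℕ → ℕ) v xs → (∀ x → f x ≢ v) → v ∈ᵇ map f xs ≡ false
∉ᵇ-map f v [] h = refl
∉ᵇ-map f v (y ∷ xs) h rewrite ≢⇒≡ᵇ-false (≢-sym (h y)) = ∉ᵇ-map f v xs h

any-false : ∀ {A : Set} (p : A → Bool) xs → All (λ x → p x ≡ false) xs → any p xs ≡ false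
any-false p [] [] = refl
any-false p (x ∷ xs) (e ∷ es) rewrite e = any-false p xs es

Column : Tab → Set
Column [] = ⊤
Column (b ∷ t) = NonEmpty b × AllPairs _<_ b × All (1 ≤_) b
                 × All (λ x → All (x <_) (concat t)) b × Column t

Column-tail : ∀ {b t} → Column (b ∷ t) → Column t
Column-tail (_ , _ , _ , _ , col) = col

AllPairs-++⁻ : ∀ xs {ys} → AllPairs _<_ (xs ++ ys) →
  AllPairs _<_ xs × All (λ x → All (x <_) ys) xs × AllPairs _<_ ys
AllPairs-++⁻ [] p = [] , [] , p
AllPairs-++⁻ (x ∷ xs) (px ∷ pxs) with AllPairs-++⁻ xs pxs | All.++⁻ xs px
... | inXs , across , inYs | pxXs , pxYs = pxXs ∷ inXs , pxYs ∷ across , inYs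

SVT⇒Column : ∀ n k t → SVT n k t → Column t
SVT⇒Column n k t (_ , nonEmptyBoxes , bounds , increasing) =
  column t nonEmptyBoxes (All.map proj₁ bounds) (Linked⇒AllPairs <-trans increasing)
  where
  column : ∀ t → All NonEmpty t → All (1 ≤_) (concat t) → AllPairs _<_ (concat t) → Column t
  column [] _ _ _ = tt
  column (b ∷ t) (ne ∷ nes) pos inc with AllPairs-++⁻ b inc | All.++⁻ b pos
  ... | incB , across , incT | posB , posT = ne , incB , posB , across , column t nes posT incT

Column-positive : ∀ t → Column t → All (0 <_) (concat t)
Column-positive [] _ = []
Column-positive (b ∷ t) (_ , _ , pos , _ , col) = All.++⁺ pos (Column-positive t col)

∉-later : ∀ v b t → Column (b ∷ t) → v ∈ᵇ b ≡ true → v ∈ᵀ t ≡ false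
∉-later v b t (_ , _ , _ , below , _) e =
  trans (∈ᵀ-concat v t) (All>⇒∉ᵇ (concat t) (All-∈ᵇ {x = v} b below e))

∉-earlier : ∀ v b t → Column (b ∷ t) → v ∈ᵀ t ≡ true → v ∈ᵇ b ≡ false
∉-earlier v b t col e with v ∈ᵇ b in inB
... | false = refl
... | true with () ← trans (sym e) (∉-later v b t col inB)

allLe : ℕ → Box → Bool
allLe m [] = true
allLe m (x ∷ b) = (x ≤ᵇ m) ∧ allLe m b

boxes : ℕ → Tab → ℕ
boxes m [] = 0
boxes m (b ∷ t) = ind (allLe m b) + boxes m t

allLe-∉ : ∀ v b → suc v ∈ᵇ b ≡ false → allLe (suc v) b ≡ allLe v b
allLe-∉ v [] _ = refl
allLe-∉ v (x ∷ b) e with suc v ≡ᵇ x in v+1≟x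
... | false rewrite ≤ᵇ-suc {x} {v} (≢-sym (≡ᵇ-false⇒≢ v+1≟x)) | allLe-∉ v b e = refl

allLe-∈ : ∀ m x b → x ∈ᵇ b ≡ true → m < x → allLe m b ≡ false
allLe-∈ m x (y ∷ b) e m<x with x ≡ᵇ y in x≟y
... | true rewrite >⇒≤ᵇ-false (subst (m <_) (≡ᵇ-sound x≟y) m<x) = refl
... | false rewrite allLe-∈ m x b e m<x = ∧-zeroʳ (y ≤ᵇ m)

allLe-mono : ∀ m b → allLe m b ≡ true → allLe (suc m) b ≡ true
allLe-mono m [] e = refl
allLe-mono m (x ∷ b) e with ∧-true {x ≤ᵇ m} e
... | x≤m , rest rewrite ≤⇒≤ᵇ-true {x} {suc m} (m≤n⇒m≤1+n (≤ᵇ-sound {x} x≤m)) = allLe-mono m b rest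

allLe-All : ∀ m b → All (_≤ m) b → allLe m b ≡ true
allLe-All m [] [] = refl
allLe-All m (x ∷ b) (x≤m ∷ ps) rewrite ≤⇒≤ᵇ-true x≤m = allLe-All m b ps

boxes-mono : ∀ v t → boxes v t ≤ boxes (suc v) t
boxes-mono v [] = z≤n
boxes-mono v (b ∷ t) = +-mono-≤ (ind-mono (allLe-mono v b)) (boxes-mono v t)

boxes-∉ : ∀ v t → suc v ∈ᵀ t ≡ false → boxes (suc v) t ≡ boxes v t
boxes-∉ v [] e = refl
boxes-∉ v (b ∷ t) e rewrite allLe-∉ v b (proj₁ (∨-false e)) | boxes-∉ v t (proj₂ (∨-false e)) = refl

-- Raising the bound by one completes at most one box (the one holding v+1).
boxes-suc : ∀ v t → Column t → boxes (suc v) t ≡ boxes v t ⊎ boxes (suc v) t ≡ suc (boxes v t)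
boxes-suc v [] _ = inj₁ refl
boxes-suc v (b ∷ t) col with suc v ∈ᵇ b in inB
... | true rewrite boxes-∉ v t (∉-later (suc v) b t col inB) | allLe-∈ v (suc v) b inB ≤-refl
      with allLe (suc v) b
...   | true = inj₂ refl
...   | false = inj₁ refl
boxes-suc v (b ∷ t) col | false rewrite allLe-∉ v b inB with boxes-suc v t (Column-tail col)
... | inj₁ e = inj₁ (cong (ind (allLe v b) +_) e)
... | inj₂ e = inj₂ (trans (cong (ind (allLe v b) +_) e) (+-suc _ _))

lowerStep : ℕ → ℕ → Tab → Tab
lowerStep n i t = gmax n (eKOp i) (gmax n (eOp i) t)

lowerValue : ℕ → ℕ → ℕ
lowerValue i x = if x ≡ᵇ suc i then i else x

holdsBoth : ℕ → Box → Bool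
holdsBoth i b = (i ∈ᵇ b) ∧ (suc i ∈ᵇ b)

dropSuc : ℕ → Box → Box
dropSuc i b = filter (λ x → ¬? (x ≟ suc i)) b

kLowerBox : ℕ → Box → Box
kLowerBox i b = if holdsBoth i b then dropSuc i b else b

eApplies : ℕ → Tab → Bool
eApplies i t = (suc i ∈ᵀ t) ∧ not (i ∈ᵀ t)

kApplies : ℕ → Tab → Bool
kApplies i t = any (holdsBoth i) t

eOp-applies : ∀ i t → eApplies i t ≡ true → eOp i t ≡ just (map (map (lowerValue i)) t)
eOp-applies i t e = cong (λ c → if c then just (map (map (lowerValue i)) t) else nothing) e

eOp-vanishes : ∀ i t → eApplies i t ≡ false → eOp i t ≡ nothing
eOp-vanishes i t e = cong (λ c → if c then just (map (map (lowerValue i)) t) else nothing) e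

eKOp-applies : ∀ i t → kApplies i t ≡ true → eKOp i t ≡ just (map (kLowerBox i) t)
eKOp-applies i t e = cong (λ c → if c then just (map (kLowerBox i) t) else nothing) e

eKOp-vanishes : ∀ i t → kApplies i t ≡ false → eKOp i t ≡ nothing
eKOp-vanishes i t e = cong (λ c → if c then just (map (kLowerBox i) t) else nothing) e

iterMax-stop : ∀ m (g : Tab → Maybe Tab) t → g t ≡ nothing → iterMax m g t ≡ t
iterMax-stop zero g t e = refl
iterMax-stop (suc m) g t e rewrite e = refl

iterMax-once : ∀ m (g : Tab → Maybe Tab) t t′ → g t ≡ just t′ → g t′ ≡ nothing → iterMax (suc m) g t ≡ t′
iterMax-once m g t t′ e e′ rewrite e = iterMax-stop m g t′ e′

lowerValue-1+i : ∀ i → lowerValue i (suc i) ≡ i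
lowerValue-1+i i rewrite ≡ᵇ-refl (suc i) = refl

lowerValue-≢ : ∀ i x → lowerValue i x ≢ suc i
lowerValue-≢ i x with x ≡ᵇ suc i in x≟i+1
... | true = ≢-sym 1+n≢n
... | false = λ e → ≡ᵇ-false⇒≢ x≟i+1 e

dropSuc-∉ : ∀ i b → suc i ∈ᵇ dropSuc i b ≡ false
dropSuc-∉ i [] = refl
dropSuc-∉ i (x ∷ b) with x ≡ᵇ suc i in x≟i+1
... | true = dropSuc-∉ i b
... | false rewrite ≢⇒≡ᵇ-false {suc i} {x} (≢-sym (≡ᵇ-false⇒≢ x≟i+1)) = dropSuc-∉ i b

dropSuc-∈ : ∀ i x b → x ∈ᵇ b ≡ true → x ≢ suc i → x ∈ᵇ dropSuc i b ≡ true
dropSuc-∈ i x (y ∷ b) e x≢i+1 with y ≡ᵇ suc i in y≟i+1 | x ≡ᵇ y in x≟y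
... | true | true = ⊥-elim (x≢i+1 (trans (≡ᵇ-sound x≟y) (≡ᵇ-sound y≟i+1)))
... | true | false = dropSuc-∈ i x b e x≢i+1
... | false | true rewrite x≟y = refl
... | false | false rewrite x≟y = dropSuc-∈ i x b e x≢i+1

eApplies-after-e : ∀ i t → eApplies i t ≡ true → eApplies i (map (map (lowerValue i)) t) ≡ false
eApplies-after-e i t e
  rewrite subst (λ u → u ∈ᵀ map (map (lowerValue i)) t ≡ true) (lowerValue-1+i i)
                (∈ᵀ-map (lowerValue i) (suc i) t (proj₁ (∧-true {suc i ∈ᵀ t} e)))
  = ∧-zeroʳ _

kApplies-after-e : ∀ i t → kApplies i (map (map (lowerValue i)) t) ≡ false
kApplies-after-e i t = any-false (holdsBoth i) _ (noneBoth t)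
  where
  noneBoth : ∀ t → All (λ b → holdsBoth i b ≡ false) (map (map (lowerValue i)) t)
  noneBoth [] = []
  noneBoth (b ∷ t) = trans (cong (i ∈ᵇ map (lowerValue i) b ∧_)
                                 (∉ᵇ-map (lowerValue i) (suc i) b (lowerValue-≢ i)))
                           (∧-zeroʳ (i ∈ᵇ map (lowerValue i) b))
                     ∷ noneBoth t

kApplies-after-k : ∀ i t → kApplies i (map (kLowerBox i) t) ≡ false
kApplies-after-k i t = any-false (holdsBoth i) _ (noneBoth t)
  where
  noneBoth : ∀ t → All (λ b → holdsBoth i b ≡ false) (map (kLowerBox i) t)
  noneBoth [] = []
  noneBoth (b ∷ t) with holdsBoth i b in both
  ... | true = trans (cong (i ∈ᵇ dropSuc i b ∧_) (dropSuc-∉ i b)) (∧-zeroʳ (i ∈ᵇ dropSuc i b)) ∷ noneBoth t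
  ... | false = both ∷ noneBoth t

lowerStep-e : ∀ n i t → eApplies i t ≡ true → lowerStep (suc n) i t ≡ map (map (lowerValue i)) t
lowerStep-e n i t e
  rewrite iterMax-once n (eOp i) t _ (eOp-applies i t e) (eOp-vanishes i _ (eApplies-after-e i t e)) =
  iterMax-stop (suc n) (eKOp i) _ (eKOp-vanishes i _ (kApplies-after-e i t))

lowerStep-k : ∀ n i t → eApplies i t ≡ false → kApplies i t ≡ true →
  lowerStep (suc n) i t ≡ map (kLowerBox i) t
lowerStep-k n i t e k rewrite iterMax-stop (suc n) (eOp i) t (eOp-vanishes i t e) =
  iterMax-once n (eKOp i) t _ (eKOp-applies i t k) (eKOp-vanishes i _ (kApplies-after-k i t))

lowerStep-id : ∀ n i t → eApplies i t ≡ false → kApplies i t ≡ false → lowerStep (suc n) i t ≡ t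
lowerStep-id n i t e k rewrite iterMax-stop (suc n) (eOp i) t (eOp-vanishes i t e) =
  iterMax-stop (suc n) (eKOp i) t (eKOp-vanishes i t k)

lowerValue-≤ : ∀ i x → lowerValue i x ≤ x
lowerValue-≤ i x with x ≡ᵇ suc i in x≟i+1
... | true = subst (i ≤_) (sym (≡ᵇ-sound x≟i+1)) (n≤1+n i)
... | false = ≤-refl

lowerValue-mono : ∀ i x y → x < y → x ≢ i → lowerValue i x < lowerValue i y
lowerValue-mono i x y x<y x≢i with y ≡ᵇ suc i in y≟i+1
... | true = ≤-<-trans (lowerValue-≤ i x) (≤∧≢⇒< (≤-pred (subst (x <_) (≡ᵇ-sound y≟i+1) x<y)) x≢i)
... | false = ≤-<-trans (lowerValue-≤ i x) x<y

lowerValue-pos : ∀ i x → 1 ≤ i → 1 ≤ x → 1 ≤ lowerValue i x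
lowerValue-pos i x 1≤i 1≤x with x ≡ᵇ suc i
... | true = 1≤i
... | false = 1≤x

Column-e : ∀ i t → 1 ≤ i → i ∈ᵀ t ≡ false → Column t → Column (map (map (lowerValue i)) t)
Column-e i [] _ _ _ = tt
Column-e i (b ∷ t) 1≤i i∉ (nonEmpty x xs , inc , pos , below , col) =
  nonEmpty _ _ , increasing b inc avoidsI ,
  All.map⁺ (All.map (λ {x} → lowerValue-pos i x 1≤i) pos) ,
  subst (λ ys → All (λ x → All (x <_) ys) (map (lowerValue i) b)) (sym (concat-map t))
        (stillBelow b below avoidsI) ,
  Column-e i t 1≤i (proj₂ (∨-false i∉)) col
  where
  avoidsI : All (_≢ i) b
  avoidsI = ∉ᵇ⇒All≢ i b (proj₁ (∨-false i∉))
  increasing : ∀ b → AllPairs _<_ b → All (_≢ i) b → AllPairs _<_ (map (lowerValue i) b)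
  increasing [] [] [] = []
  increasing (x ∷ b) (x<b ∷ inc) (x≢i ∷ ne) =
    All.map⁺ (All.map (λ {y} x<y → lowerValue-mono i x y x<y x≢i) x<b) ∷ increasing b inc ne
  stillBelow : ∀ b {ys} → All (λ x → All (x <_) ys) b → All (_≢ i) b →
    All (λ x → All (x <_) (map (lowerValue i) ys)) (map (lowerValue i) b)
  stillBelow [] [] [] = []
  stillBelow (x ∷ b) (x<ys ∷ ps) (x≢i ∷ ne) =
    All.map⁺ (All.map (λ {y} x<y → lowerValue-mono i x y x<y x≢i) x<ys) ∷ stillBelow b ps ne

-- e_i^K only deletes entries, so it keeps t a column.
kLowerBox-All : ∀ {P : ℕ → Set} i b → All P b → All P (kLowerBox i b)
kLowerBox-All i b p with holdsBoth i b
... | true = All.filter⁺ (λ x → ¬? (x ≟ suc i)) p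
... | false = p

kLowerBox-AllPairs : ∀ i b → AllPairs _<_ b → AllPairs _<_ (kLowerBox i b)
kLowerBox-AllPairs i b p with holdsBoth i b
... | true = AllPairs.filter⁺ (λ x → ¬? (x ≟ suc i)) p
... | false = p

kLowerBox-NonEmpty : ∀ i b → NonEmpty b → NonEmpty (kLowerBox i b)
kLowerBox-NonEmpty i b p with holdsBoth i b in both
... | false = p
... | true with dropSuc i b | dropSuc-∈ i i b (proj₁ (∧-true {i ∈ᵇ b} both)) (≢-sym 1+n≢n)
...   | y ∷ ys | _ = nonEmpty y ys

concat-kLowerBox : ∀ {P : ℕ → Set} i t → All P (concat t) → All P (concat (map (kLowerBox i) t))
concat-kLowerBox i [] p = []
concat-kLowerBox i (b ∷ t) p with All.++⁻ b p
... | pb , pt = All.++⁺ (kLowerBox-All i b pb) (concat-kLowerBox i t pt)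

Column-k : ∀ i t → Column t → Column (map (kLowerBox i) t)
Column-k i [] _ = tt
Column-k i (b ∷ t) (ne , inc , pos , below , col) =
  kLowerBox-NonEmpty i b ne , kLowerBox-AllPairs i b inc , kLowerBox-All i b pos ,
  kLowerBox-All i b (All.map (λ {x} → concat-kLowerBox i t) below) , Column-k i t col

allLe-e-≢ : ∀ i m b → m ≢ i → allLe m (map (lowerValue i) b) ≡ allLe m b
allLe-e-≢ i m [] m≢i = refl
allLe-e-≢ i m (x ∷ b) m≢i with x ≡ᵇ suc i in x≟i+1
... | true rewrite ≡ᵇ-sound {x} {suc i} x≟i+1 | ≤ᵇ-shift i m m≢i | allLe-e-≢ i m b m≢i = refl
... | false rewrite allLe-e-≢ i m b m≢i = refl

allLe-e-at : ∀ i b → allLe i (map (lowerValue i) b) ≡ allLe (suc i) b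
allLe-e-at i [] = refl
allLe-e-at i (x ∷ b) with x ≡ᵇ suc i in x≟i+1
... | true rewrite ≡ᵇ-sound {x} {suc i} x≟i+1 | ≤⇒≤ᵇ-true (≤-refl {i}) | ≤⇒≤ᵇ-true (≤-refl {suc i}) =
  allLe-e-at i b
... | false rewrite ≤ᵇ-suc {x} {i} (≡ᵇ-false⇒≢ x≟i+1) | allLe-e-at i b = refl

boxes-e-≢ : ∀ i m t → m ≢ i → boxes m (map (map (lowerValue i)) t) ≡ boxes m t
boxes-e-≢ i m [] m≢i = refl
boxes-e-≢ i m (b ∷ t) m≢i rewrite allLe-e-≢ i m b m≢i | boxes-e-≢ i m t m≢i = refl

boxes-e-at : ∀ i t → boxes i (map (map (lowerValue i)) t) ≡ boxes (suc i) t
boxes-e-at i [] = refl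
boxes-e-at i (b ∷ t) rewrite allLe-e-at i b | boxes-e-at i t = refl

-- Box counts after e_i^K.  When e_i^K applies, i and i+1 sit in the same
-- box, i.e. every box contains i exactly when it contains i+1.
SameBox : ℕ → Tab → Set
SameBox i t = All (λ b → (i ∈ᵇ b) ≡ (suc i ∈ᵇ b)) t

kApplies-∈ : ∀ i t → kApplies i t ≡ true → i ∈ᵀ t ≡ true × suc i ∈ᵀ t ≡ true
kApplies-∈ i (b ∷ t) e with ∨-true {holdsBoth i b} e
... | inj₁ both = ∨-trueˡ (proj₁ (∧-true {i ∈ᵇ b} both)) , ∨-trueˡ (proj₂ (∧-true {i ∈ᵇ b} both))
... | inj₂ later = ∨-trueʳ (proj₁ (kApplies-∈ i t later)) , ∨-trueʳ (proj₂ (kApplies-∈ i t later))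

kApplies⇒SameBox : ∀ i t → Column t → kApplies i t ≡ true → SameBox i t
kApplies⇒SameBox i (b ∷ t) col e with holdsBoth i b in both
... | true = trans i∈b (sym i+1∈b) ∷ neither (∉ᵀ⇒All∉ᵇ i t (∉-later i b t col i∈b))
                                              (∉ᵀ⇒All∉ᵇ (suc i) t (∉-later (suc i) b t col i+1∈b))
  where
  i∈b = proj₁ (∧-true {i ∈ᵇ b} both)
  i+1∈b = proj₂ (∧-true {i ∈ᵇ b} both)
  neither : ∀ {t} → All (λ c → i ∈ᵇ c ≡ false) t → All (λ c → suc i ∈ᵇ c ≡ false) t → SameBox i t
  neither [] [] = []
  neither (p ∷ ps) (q ∷ qs) = trans p (sym q) ∷ neither ps qs
... | false = trans (∉-earlier i b t col i∈t) (sym (∉-earlier (suc i) b t col i+1∈t))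
              ∷ kApplies⇒SameBox i t (Column-tail col) e
  where
  i∈t = proj₁ (kApplies-∈ i t e)
  i+1∈t = proj₂ (kApplies-∈ i t e)

allLe-dropSuc-above : ∀ i m b → suc i ≤ m → allLe m (dropSuc i b) ≡ allLe m b
allLe-dropSuc-above i m [] _ = refl
allLe-dropSuc-above i m (x ∷ b) i<m with x ≡ᵇ suc i in x≟i+1
... | true rewrite ≡ᵇ-sound {x} {suc i} x≟i+1 | ≤⇒≤ᵇ-true i<m = allLe-dropSuc-above i m b i<m
... | false rewrite allLe-dropSuc-above i m b i<m = refl

allLe-dropSuc-at : ∀ i b → allLe i (dropSuc i b) ≡ allLe (suc i) b
allLe-dropSuc-at i [] = refl
allLe-dropSuc-at i (x ∷ b) with x ≡ᵇ suc i in x≟i+1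
... | true rewrite ≡ᵇ-sound {x} {suc i} x≟i+1 | ≤⇒≤ᵇ-true (≤-refl {suc i}) = allLe-dropSuc-at i b
... | false rewrite ≤ᵇ-suc {x} {i} (≡ᵇ-false⇒≢ x≟i+1) | allLe-dropSuc-at i b = refl

allLe-k-≢ : ∀ i m b → m ≢ i → allLe m (kLowerBox i b) ≡ allLe m b
allLe-k-≢ i m b m≢i with holdsBoth i b in both
... | false = refl
... | true with suc i ≤? m
...   | yes i<m = allLe-dropSuc-above i m b i<m
...   | no i≮m = trans (allLe-∈ m i (dropSuc i b) (dropSuc-∈ i i b i∈b (≢-sym 1+n≢n)) m<i)
                       (sym (allLe-∈ m i b i∈b m<i))
  where
  i∈b = proj₁ (∧-true {i ∈ᵇ b} both)
  m<i = ≤∧≢⇒< (≤-pred (≰⇒> i≮m)) m≢i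

boxes-k-≢ : ∀ i m t → m ≢ i → boxes m (map (kLowerBox i) t) ≡ boxes m t
boxes-k-≢ i m [] m≢i = refl
boxes-k-≢ i m (b ∷ t) m≢i rewrite allLe-k-≢ i m b m≢i | boxes-k-≢ i m t m≢i = refl

boxes-k-at : ∀ i t → SameBox i t → boxes i (map (kLowerBox i) t) ≡ boxes (suc i) t
boxes-k-at i [] _ = refl
boxes-k-at i (b ∷ t) (same ∷ sames) rewrite boxes-k-at i t sames with holdsBoth i b in both
... | true rewrite allLe-dropSuc-at i b = refl
... | false with i ∈ᵇ b in i∈b
...   | true with () ← trans same both
...   | false rewrite allLe-∉ i b (sym same) = refl

boxes-SameBox : ∀ j t → SameBox (suc j) t → boxes (suc j) t ≡ boxes j t
boxes-SameBox j [] _ = refl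
boxes-SameBox j (b ∷ t) (same ∷ sames) rewrite boxes-SameBox j t sames with suc j ∈ᵇ b in inB
... | false rewrite allLe-∉ j b inB = refl
... | true rewrite allLe-∈ (suc j) (suc (suc j)) b (sym same) ≤-refl
                 | allLe-∈ j (suc j) b inB ≤-refl = refl

later-larger : ∀ x y b t → Column (b ∷ t) → x ∈ᵇ b ≡ true → y ∈ᵀ t ≡ true → x < y
later-larger x y b t (_ , _ , _ , below , _) x∈b y∈t =
  All-∈ᵇ {x = y} (concat t) (All-∈ᵇ {x = x} b below x∈b) (trans (sym (∈ᵀ-concat y t)) y∈t)

∈ᵀ-tail : ∀ v b t → v ∈ᵀ (b ∷ t) ≡ true → v ∈ᵇ b ≡ false → v ∈ᵀ t ≡ true
∈ᵀ-tail v b t e v∉b = subst (λ u → u ∨ (v ∈ᵀ t) ≡ true) v∉b e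

allLe-before : ∀ m b t → Column (b ∷ t) → suc m ∈ᵀ t ≡ true → allLe m b ≡ true
allLe-before m b t (_ , _ , _ , below , _) e = allLe-All m b (All.map (λ {x} x<t → ≤-pred
  (All-∈ᵇ {x = suc m} (concat t) x<t (trans (sym (∈ᵀ-concat (suc m) t)) e))) below)

-- If neither operator applies at i = j+1 and i+1 ∈ t, then i lies in an
-- earlier box than i+1, and that box completes exactly at i.
boxes-complete-at : ∀ j t → Column t → kApplies (suc j) t ≡ false →
  suc j ∈ᵀ t ≡ true → suc (suc j) ∈ᵀ t ≡ true → boxes (suc j) t ≡ suc (boxes j t)
boxes-complete-at j (b ∷ t) col noK i∈ i+1∈ with suc j ∈ᵇ b in i∈b
... | true with ∈ᵀ-tail (suc (suc j)) b t i+1∈ (proj₁ (∨-false {suc (suc j) ∈ᵇ b} noK))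
...   | i+1∈t rewrite allLe-before (suc j) b t col i+1∈t
                      | allLe-∈ j (suc j) b i∈b ≤-refl
                      | boxes-∉ j t (∉-later (suc j) b t col i∈b) = refl
boxes-complete-at j (b ∷ t) col noK i∈ i+1∈ | false with suc (suc j) ∈ᵇ b in i+1∈b
...   | true = ⊥-elim (<-asym (n<1+n (suc j)) (later-larger (suc (suc j)) (suc j) b t col i+1∈b i∈))
...   | false rewrite allLe-∉ j b i∈b =
  trans (cong (ind (allLe j b) +_) (boxes-complete-at j t (Column-tail col) (proj₂ (∨-false noK))
                                      i∈ i+1∈))
        (+-suc _ _)

not≡true : ∀ {a} → not a ≡ true → a ≡ false
not≡true {false} _ = refl

-- How one lowering step at i = j+1 moves the box counts μ₀, μ₁, μ₂ of t
-- at j, i, i+1; μ₁′ is the count at i afterwards.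
data CountShift (μ₀ μ₁ μ₂ μ₁′ : ℕ) : Set where
  -- e_i or e_i^K acted: the count at i becomes the old count at i+1.
  shifted : μ₁′ ≡ μ₂ → μ₁ ≡ μ₀ → μ₂ ≡ μ₁ ⊎ μ₂ ≡ suc μ₁ → CountShift μ₀ μ₁ μ₂ μ₁′
  -- nothing acted: either no box completes at i+1, or one completes at i.
  unchanged : μ₁′ ≡ μ₁ → μ₂ ≡ μ₁ ⊎ μ₁ ≡ suc μ₀ → CountShift μ₀ μ₁ μ₂ μ₁′

record StepEffect (j : ℕ) (t t′ : Tab) : Set where
  field
    column      : Column t′
    same-length : length t′ ≡ length t
    boxes-same  : ∀ m → m ≢ suc j → boxes m t′ ≡ boxes m t
    shift       : CountShift (boxes j t) (boxes (suc j) t) (boxes (suc (suc j)) t) (boxes (suc j) t′)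

e-effect : ∀ j t → Column t → eApplies (suc j) t ≡ true → StepEffect j t (map (map (lowerValue (suc j))) t)
e-effect j t col e = record
  { column = Column-e (suc j) t (s≤s z≤n) i∉t col
  ; same-length = length-map _ t
  ; boxes-same = λ m → boxes-e-≢ (suc j) m t
  ; shift = shifted (boxes-e-at (suc j) t) (boxes-∉ j t i∉t) (boxes-suc (suc j) t col) }
  where
  i∉t : suc j ∈ᵀ t ≡ false
  i∉t = not≡true (proj₂ (∧-true {suc (suc j) ∈ᵀ t} e))

k-effect : ∀ j t → Column t → kApplies (suc j) t ≡ true → StepEffect j t (map (kLowerBox (suc j)) t)
k-effect j t col k = record
  { column = Column-k (suc j) t col
  ; same-length = length-map _ t
  ; boxes-same = λ m → boxes-k-≢ (suc j) m t
  ; shift = shifted (boxes-k-at (suc j) t same) (boxes-SameBox j t same) (boxes-suc (suc j) t col) }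
  where
  same = kApplies⇒SameBox (suc j) t col k

id-effect : ∀ j t → Column t → eApplies (suc j) t ≡ false → kApplies (suc j) t ≡ false → StepEffect j t t
id-effect j t col e k = record
  { column = col
  ; same-length = refl
  ; boxes-same = λ _ _ → refl
  ; shift = unchanged refl completion }
  where
  completion : boxes (suc (suc j)) t ≡ boxes (suc j) t ⊎ boxes (suc j) t ≡ suc (boxes j t)
  completion with suc (suc j) ∈ᵀ t in i+1∈
  ... | false = inj₁ (boxes-∉ (suc j) t i+1∈)
  ... | true with suc j ∈ᵀ t in i∈
  ...   | true = inj₂ (boxes-complete-at j t col k i∈ i+1∈)
  ...   | false = ⊥-elim (true≢false e)

lowerStep-effect : ∀ n j t → Column t → StepEffect j t (lowerStep (suc n) (suc j) t)
lowerStep-effect n j t col = byCase (eApplies (suc j) t) refl (kApplies (suc j) t) refl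
  where
  byCase : ∀ c → eApplies (suc j) t ≡ c → ∀ d → kApplies (suc j) t ≡ d →
    StepEffect j t (lowerStep (suc n) (suc j) t)
  byCase true e _ _ = subst (StepEffect j t) (sym (lowerStep-e n (suc j) t e)) (e-effect j t col e)
  byCase false e true k = subst (StepEffect j t) (sym (lowerStep-k n (suc j) t e k)) (k-effect j t col k)
  byCase false e false k = subst (StepEffect j t) (sym (lowerStep-id n (suc j) t e k)) (id-effect j t col e k)

Dominated : (ℕ → Bool) → Tab → Set
Dominated P t = ∀ m → count P m ≤ boxes m t

Dominated-cong : ∀ P Q t → (∀ v → P v ≡ Q v) → Dominated P t → Dominated Q t
Dominated-cong P Q t P≡Q dom m = subst (_≤ boxes m t) (count-cong P Q m (λ v _ _ → P≡Q v)) (dom m)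

-- The only inequality affected by a step: with p₁, p₂ the membership of i
-- and i+1 in the image, σ₀ the count up to j, the condition at i before
-- the step (for the relabelled image) and after it (for the old image)
-- agree, given the neighbouring inequalities and the absence of an ascent.
critical : ∀ (p₁ p₂ : Bool) σ₀ μ₀ μ₁ μ₂ μ₁′ → ¬ (p₂ ≡ true × p₁ ≡ false) →
  σ₀ ≤ μ₀ → ind p₂ + (ind p₁ + σ₀) ≤ μ₂ → μ₀ ≤ μ₁ → CountShift μ₀ μ₁ μ₂ μ₁′ →
  (ind p₁ + σ₀ ≤ μ₁′) ⇔ (ind p₂ + σ₀ ≤ μ₁)
critical false false _ _ _ _ _ _ σ≤μ₀ below μ₀≤μ₁ (shifted refl _ _) =
  mk⇔ (λ _ → ≤-trans σ≤μ₀ μ₀≤μ₁) (λ _ → below)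
critical false false _ _ _ _ _ _ σ≤μ₀ _ μ₀≤μ₁ (unchanged refl _) =
  mk⇔ (λ _ → ≤-trans σ≤μ₀ μ₀≤μ₁) id
critical false true _ _ _ _ _ noAscent _ _ _ _ = ⊥-elim (noAscent (refl , refl))
critical true false _ _ _ _ _ _ σ≤μ₀ below μ₀≤μ₁ (shifted refl _ _) =
  mk⇔ (λ _ → ≤-trans σ≤μ₀ μ₀≤μ₁) (λ _ → below)
critical true false _ _ _ _ _ _ σ≤μ₀ below μ₀≤μ₁ (unchanged refl (inj₁ refl)) =
  mk⇔ (λ _ → ≤-trans σ≤μ₀ μ₀≤μ₁) (λ _ → below)
critical true false _ _ _ _ _ _ σ≤μ₀ _ μ₀≤μ₁ (unchanged refl (inj₂ refl)) =
  mk⇔ (λ _ → ≤-trans σ≤μ₀ μ₀≤μ₁) (λ _ → s≤s σ≤μ₀)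
critical true true _ _ _ _ _ _ _ _ _ (shifted refl _ (inj₁ refl)) = mk⇔ id id
critical true true _ _ _ _ _ _ _ below _ (shifted refl _ (inj₂ refl)) = mk⇔ (λ _ → ≤-pred below) m≤n⇒m≤1+n
critical true true _ _ _ _ _ _ _ _ _ (unchanged refl _) = mk⇔ id id

dominated-step : ∀ n j r k t → ValidWord (suc n) (suc j ∷ r) → Reduced (suc n) (suc j ∷ r) → Column t →
  Dominated (img (wordAct r) k) (lowerStep (suc n) (suc j) t) ⇔ Dominated (img (wordAct (suc j ∷ r)) k) t
dominated-step n j r k t valid red col =
  mk⇔ (λ dom → Dominated-cong Ps Q t (λ v → sym (img-sAct i (wordAct r) k v)) (before dom))
      (λ dom → after (Dominated-cong Q Ps t (λ v → img-sAct i (wordAct r) k v) dom))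
  where
  i = suc j
  P = img (wordAct r) k
  Q = img (wordAct (i ∷ r)) k
  open CountSwap P j
  t′ = lowerStep (suc n) i t
  open StepEffect (lowerStep-effect n j t col)
  j≢i : j ≢ i
  j≢i = ≢-sym 1+n≢n
  i+1≢i : suc i ≢ i
  i+1≢i = 1+n≢n
  critical-at-i : count P j ≤ boxes j t → ind (P (suc i)) + count P i ≤ boxes (suc i) t →
    (count P i ≤ boxes i t′) ⇔ (ind (P (suc i)) + count P j ≤ boxes i t)
  critical-at-i σ≤μ₀ below = critical (P i) (P (suc i)) (count P j) (boxes j t) (boxes i t)
    (boxes (suc i) t) (boxes i t′) (λ (a , b) → reduced-no-ascent {k = k} valid red a b)
    σ≤μ₀ below (boxes-mono j t) shift
  before : Dominated P t′ → Dominated Ps t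
  before dom m with m ≟ i
  ... | no m≢i = subst₂ _≤_ (sym (count-swap m m≢i)) (boxes-same m m≢i) (dom m)
  ... | yes refl = subst (_≤ boxes i t) (sym count-at)
    (Equivalence.to (critical-at-i (subst (count P j ≤_) (boxes-same j j≢i) (dom j))
                                   (subst (count P (suc i) ≤_) (boxes-same (suc i) i+1≢i) (dom (suc i))))
                    (dom i))
  after : Dominated Ps t → Dominated P t′
  after dom m with m ≟ i
  ... | no m≢i = subst₂ _≤_ (count-swap m m≢i) (sym (boxes-same m m≢i)) (dom m)
  ... | yes refl =
    Equivalence.from (critical-at-i (subst (_≤ boxes j t) (count-below j ≤-refl) (dom j))
                                    (subst (_≤ boxes (suc i) t) (count-swap (suc i) i+1≢i) (dom (suc i))))
                     (subst (_≤ boxes i t) count-at (dom i))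

column-from : ℕ → ℕ → Tab
column-from a zero = []
column-from a (suc k) = (suc a ∷ []) ∷ column-from (suc a) k

uCol≡column-from : ∀ k → uCol k ≡ column-from 0 k
uCol≡column-from k = shifted-from k (λ j → j) 0 (λ j → refl)
  where
  shifted-from : ∀ k (h : ℕ → ℕ) a → (∀ j → h j ≡ a + j) →
    map (λ j → suc j ∷ []) (applyUpTo h k) ≡ column-from a k
  shifted-from zero h a e = refl
  shifted-from (suc k) h a e = cong₂ _∷_ (cong (λ u → suc u ∷ []) (trans (e 0) (+-identityʳ a)))
    (shifted-from k (λ j → h (suc j)) (suc a) (λ j → trans (e (suc j)) (+-suc a j)))

count-identity : ∀ k m → count (img (wordAct []) k) m ≡ m ⊓ k
count-identity k m = trans (count-cong _ _ m (λ v 1≤v _ → img-id k v 1≤v)) (count-≤ᵇ m)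
  where
  img-id : ∀ k v → 1 ≤ v → img (wordAct []) k v ≡ (v ≤ᵇ k)
  img-id zero v 1≤v = sym (>⇒≤ᵇ-false 1≤v)
  img-id (suc k) v 1≤v with v ≟ suc k
  ... | yes refl rewrite ≡ᵇ-refl v | ≤⇒≤ᵇ-true (≤-refl {v}) = refl
  ... | no v≢1+k rewrite ≢⇒≡ᵇ-false (≢-sym v≢1+k) | ≤ᵇ-suc {v} {k} v≢1+k = img-id k v 1≤v
  count-≤ᵇ : ∀ m → count (λ v → v ≤ᵇ k) m ≡ m ⊓ k
  count-≤ᵇ zero = refl
  count-≤ᵇ (suc m) with suc m ≤? k
  ... | yes m<k rewrite ≤⇒≤ᵇ-true m<k | count-≤ᵇ m
                      | m≤n⇒m⊓n≡m (<⇒≤ m<k) | m≤n⇒m⊓n≡m m<k = refl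
  ... | no m≮k rewrite >⇒≤ᵇ-false (≰⇒> m≮k) | count-≤ᵇ m
                     | m≥n⇒m⊓n≡n (≤-pred (≰⇒> m≮k)) | m≥n⇒m⊓n≡n (m≤n⇒m≤1+n (≤-pred (≰⇒> m≮k))) = refl

boxes-column-from : ∀ k a m → m ⊓ k ≤ boxes (m + a) (column-from a k)
boxes-column-from zero a m rewrite ⊓-zeroʳ m = z≤n
boxes-column-from (suc k) a zero = z≤n
boxes-column-from (suc k) a (suc m) rewrite ≤⇒≤ᵇ-true (s≤s (m≤n+m a m)) =
  s≤s (subst (λ u → m ⊓ k ≤ boxes u (column-from (suc a) k)) (+-suc m a) (boxes-column-from k (suc a) m))

boxes-below-entries : ∀ v t → Column t → All (v <_) (concat t) → boxes v t ≡ 0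
boxes-below-entries v [] _ _ = refl
boxes-below-entries v ((x ∷ xs) ∷ t) col (v<x ∷ v<rest) rewrite >⇒≤ᵇ-false v<x =
  boxes-below-entries v t (Column-tail col) (proj₂ (All.++⁻ xs v<rest))

singleton-box : ∀ a x xs → AllPairs _<_ (x ∷ xs) → x ≡ suc a → allLe (suc a) (x ∷ xs) ≡ true → xs ≡ []
singleton-box a x [] _ _ _ = refl
singleton-box a x (y ∷ ys) ((x<y ∷ _) ∷ _) refl complete =
  ⊥-elim (<-irrefl refl (<-≤-trans x<y y≤a+1))
  where
  y≤a+1 : y ≤ suc a
  y≤a+1 = ≤ᵇ-sound {y} (proj₁ (∧-true {y ≤ᵇ suc a} (proj₂ (∧-true {x ≤ᵇ suc a} complete))))

-- u is the only column of height k, entries > a, dominating min(m,k):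
-- the first box must be complete at a+1, hence equal to {a+1}.
column-from-unique : ∀ k a t → Column t → All (a <_) (concat t) → length t ≡ k →
  (∀ m → m ⊓ k ≤ boxes (m + a) t) → t ≡ column-from a k
column-from-unique zero a [] _ _ _ _ = refl
column-from-unique (suc k) a ((x ∷ xs) ∷ t) (_ , inc , _ , x<t ∷ _ , col) (a<x ∷ _) len dom =
  cong₂ _∷_ (cong₂ _∷_ x≡a+1 xs≡[]) (column-from-unique k (suc a) t col a+1<t (suc-injective len) dom′)
  where
  a+1<t : All (suc a <_) (concat t)
  a+1<t = All.map (λ {y} x<y → ≤-<-trans a<x x<y) x<t
  first-complete : allLe (suc a) (x ∷ xs) ≡ true
  first-complete with allLe (suc a) (x ∷ xs) | dom 1
  ... | true | _ = refl
  ... | false | 1≤boxes rewrite boxes-below-entries (suc a) t col a+1<t = ⊥-elim (1+n≰n 1≤boxes)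
  x≤a+1 = ≤ᵇ-sound {x} (proj₁ (∧-true {x ≤ᵇ suc a} first-complete))
  x≡a+1 : x ≡ suc a
  x≡a+1 = ≤-antisym x≤a+1 a<x
  xs≡[] : xs ≡ []
  xs≡[] = singleton-box a x xs inc x≡a+1 first-complete
  dom′ : ∀ m → m ⊓ k ≤ boxes (m + suc a) t
  dom′ m = subst (λ u → m ⊓ k ≤ boxes u t) (sym (+-suc m a))
    (≤-pred (≤-trans (dom (suc m)) (+-monoˡ-≤ _ (ind≤1 (allLe (suc (m + a)) (x ∷ xs))))))

dominated-base : ∀ k t → Column t → length t ≡ k → (t ≡ uCol k) ⇔ Dominated (img (wordAct []) k) t
dominated-base k t col len = mk⇔
  (λ t≡u m → subst₂ _≤_ (sym (count-identity k m))
                         (cong₂ boxes (+-identityʳ m) (sym (trans t≡u (uCol≡column-from k))))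
                         (boxes-column-from k 0 m))
  (λ dom → trans (column-from-unique k 0 t col (Column-positive t col) len
                   (λ m → subst₂ _≤_ (count-identity k m) (cong (λ u → boxes u t) (sym (+-identityʳ m)))
                                     (dom m)))
                 (sym (uCol≡column-from k)))

lower-dominated : ∀ n k a t → ValidWord (suc n) a → Reduced (suc n) a → Column t → length t ≡ k →
  (lower (suc n) a t ≡ uCol k) ⇔ Dominated (img (wordAct a) k) t
lower-dominated n k [] t _ _ col len = dominated-base k t col len
lower-dominated n k (zero ∷ r) t ((() , _) ∷ _) _ _ _
lower-dominated n k (suc j ∷ r) t valid@(vi ∷ validr) red col len =
  dominated-step n j r k t valid red col
  ⇔-∘ lower-dominated n k r t′ validr (reduced-tail {r = r} vi red) (StepEffect.column effect)
                      (trans (StepEffect.same-length effect) len)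
  where
  t′ = lowerStep (suc n) (suc j) t
  effect = lowerStep-effect n j t col

lemma7p7 : (n k : ℕ) → 2 ≤ n → 1 ≤ k → k ≤ n → (w : Permutation′ n)
    → (a b : List ℕ) → IsReducedExpr n w a → IsReducedExpr n w b
    → (t : Tab) → SVTw n k a t ⇔ SVTw n k b t
lemma7p7 (suc n) k _ _ k≤n w a b reducedA reducedB t =
  mk⇔ (transfer a b reducedA reducedB) (transfer b a reducedB reducedA)
  where
  -- Both conditions are dominance of the same image w({1,…,k}).
  characterise : ∀ a → IsReducedExpr (suc n) w a → SVT (suc n) k t →
    (lower (suc n) a t ≡ uCol k) ⇔ Dominated (img (wordAct a) k) t
  characterise a reduced svt@(height , _) = lower-dominated n k a t (proj₁ reduced)
    (reduced-of-expr (suc n) w a reduced) (SVT⇒Column (suc n) k t svt) height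
  transfer : ∀ a b → IsReducedExpr (suc n) w a → IsReducedExpr (suc n) w b →
    SVTw (suc n) k a t → SVTw (suc n) k b t
  transfer a b reducedA reducedB (svt , lowersA) = svt ,
    Equivalence.from (characterise b reducedB svt)
      (Dominated-cong _ _ t (img-reducedExpr (suc n) k w a b k≤n reducedA reducedB)
        (Equivalence.to (characterise a reducedA svt) lowersA))
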